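{- Let $\mathscr L\subseteq\{+,-,0\}^E$ be an affine oriented matroid satisfying (Z), and let $B$ be a basis of its underlying semimatroid. Then there is a unique minimal element $X_B$ of the covector poset $\mathrm{Cov}(\mathscr L)$ with $B\subseteq z(X_B)$; in fact $X_B$ is the only $Y\in\mathscr L$ with $B\subseteq z(Y)$.
   Context: Sign vectors on $E$: maps $X:E\to\{+,-,0\}$; $z(X)=\{e:X(e)=0\}$, $\underline X=E\setminus z(X)$, $S(X,Y)=\{e\in\underline X\cap\underline Y:X(e)\ne Y(e)\}$, $(X\circ Y)(e)=X(e)$ if $X(e)\ne0$ else $Y(e)$, $(X\oplus Y)(e)=0$ if $e\in S(X,Y)$ else $(X\circ Y)(e)$. $\mathrm{Cov}(\mathscr L)$ is $\mathscr L$ ordered componentwise with $0<+$, $0<-$. For $\mathscr L$: $I_e(X,Y)=\{Z\in\mathscr L:Z(e)=0,\ Z(f)=(X\circ Y)(f)\ \forall f\notin S(X,Y)\}$, $I(X,Y)=\bigcup_{e\in S(X,Y)}I_e(X,Y)$, $\mathcal P(\mathscr L)=\{X\oplus(-Y):X,Y\in\mathscr L,\ I(X,-Y)=I(-X,Y)=\emptyset\}$. AOM: (FS) $X\circ(-Y)\in\mathscr L$; (SE) $I_e(X,Y)\ne\emptyset$ for $e\in S(X,Y)$; (P) $P\circ X\in\mathscr L$ for $P\in\mathcal P(\mathscr L)$, $X\in\mathscr L$. (Z): $|z(X)|<\infty$ for all $X$. Flats $\{z(X):X\in\mathscr L\}$ ordered by inclusion; central sets $\mathcal C=\{A:A\subseteq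 z(X)\text{ for some }X\}$; $\mathrm{rk}(A)$ for $A\in\mathcal C$ is the maximal length of a chain of flats ending at the inclusion-minimal flat containing $A$; a basis is $B\in\mathcal C$ with $\mathrm{rk}(B)=|B|=\max_{A\in\mathcal C}\mathrm{rk}(A)$. -}

module Defs where

open import Data.Nat using (ℕ; suc; _≤_)
open import Data.Fin using (Fin; inject₁; fromℕ)
open import Data.List using (List; length)
open import Data.List.Membership.Propositional using (_∈_)
open import Data.List.Relation.Unary.Unique.Propositional using (Unique)
open import Data.Product using (Σ; ∃; _×_; _,_)
open import Data.Sum using (_⊎_)
open import Relation.Binary.PropositionalEquality using (_≡_; _≢_)
open import Relation.Nullary using (¬_)
open import Level using (Level) renaming (suc to lsuc)

data Sign : Set where
  ⊕ ⊖ 𝟎 : Sign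

neg : Sign → Sign
neg ⊕ = ⊖
neg ⊖ = ⊕
neg 𝟎 = 𝟎

module _ {E : Set} where

  SignVec : Set
  SignVec = E → Sign

  Subset : Set₁
  Subset = E → Set

  _⊆_ : Subset → Subset → Set
  A ⊆ B = ∀ e → A e → B e

  _≐_ : Subset → Subset → Set
  A ≐ B = (A ⊆ B) × (B ⊆ A)

  _⊂_ : Subset → Subset → Set
  A ⊂ B = (A ⊆ B) × ¬ (B ⊆ A)

  _≗ˢ_ : SignVec → SignVec → Set
  X ≗ˢ Y = ∀ e → X e ≡ Y e

  z : SignVec → Subset
  z X e = X e ≡ 𝟎

  ⁻ : SignVec → SignVec
  ⁻ X e = neg (X e)

  S : SignVec → SignVec → Subset
  S X Y e = (X e ≢ 𝟎) × (Y e ≢ 𝟎) × (X e ≢ Y e)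

  comp : Sign → Sign → Sign
  comp ⊕ _ = ⊕
  comp ⊖ _ = ⊖
  comp 𝟎 t = t

  _∘ˢ_ : SignVec → SignVec → SignVec
  (X ∘ˢ Y) e = comp (X e) (Y e)

  oplus : Sign → Sign → Sign
  oplus ⊕ ⊖ = 𝟎
  oplus ⊖ ⊕ = 𝟎
  oplus s t = comp s t

  _⊕ˢ_ : SignVec → SignVec → SignVec
  (X ⊕ˢ Y) e = oplus (X e) (Y e)

  _≤ᶜ_ : SignVec → SignVec → Set
  X ≤ᶜ Y = ∀ e → (X e ≡ 𝟎) ⊎ (X e ≡ Y e)

  HasCard : Subset → ℕ → Set
  HasCard A n = Σ (List E) λ l → (length l ≡ n) × Unique l × (∀ e → (A e → e ∈ l) × (e ∈ l → A e))

  Finite : Subset → Set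
  Finite A = ∃ λ n → HasCard A n

  module _ (ℒ : SignVec → Set) where

    InI : E → SignVec → SignVec → SignVec → Set
    InI e X Y Z = ℒ Z × (Z e ≡ 𝟎) × (∀ f → ¬ S X Y f → Z f ≡ (X ∘ˢ Y) f)

    IEmpty : SignVec → SignVec → Set
    IEmpty X Y = ¬ (Σ E λ e → S X Y e × Σ SignVec λ Z → InI e X Y Z)

    FS : Set
    FS = ∀ X Y → ℒ X → ℒ Y → ℒ (X ∘ˢ ⁻ Y)

    SE : Set
    SE = ∀ X Y → ℒ X → ℒ Y → ∀ e → S X Y e → Σ SignVec λ Z → InI e X Y Z

    -- P ∘ W ∈ ℒ for P = X ⊕ (−Y) ∈ 𝒫(ℒ), W ∈ ℒ
    PAx : Set
    PAx = ∀ X Y → ℒ X → ℒ Y → IEmpty X (⁻ Y) → IEmpty (⁻ X) Y →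
          ∀ W → ℒ W → ℒ ((X ⊕ˢ ⁻ Y) ∘ˢ W)

    record IsAOM : Set where
      field
        fs : FS
        se : SE
        p  : PAx

    ZFinite : Set
    ZFinite = ∀ X → ℒ X → Finite (z X)

    -- underlying semimatroid: flats z(X), central sets, rank, bases
    Central : Subset → Set
    Central A = Σ SignVec λ X → ℒ X × (A ⊆ z X)

    ChainTo : Subset → ℕ → Set
    ChainTo F r = Σ (Fin (suc r) → SignVec) λ c →
      (∀ i → ℒ (c i)) ×
      (∀ (i : Fin r) → z (c (inject₁ i)) ⊂ z (c (Fin.suc i))) ×
      (z (c (fromℕ r)) ≐ F)

    MaxChainLen : Subset → ℕ → Set
    MaxChainLen F r = ChainTo F r × (∀ m → ChainTo F m → m ≤ r)

    MinimalFlatOver : Subset → SignVec → Set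
    MinimalFlatOver A X = ℒ X × (A ⊆ z X) ×
      (∀ Y → ℒ Y → A ⊆ z Y → z Y ⊆ z X → z X ⊆ z Y)

    Rank : Subset → ℕ → Set
    Rank A r = Σ SignVec λ X → MinimalFlatOver A X × MaxChainLen (z X) r

    IsBasis : Subset → Set₁
    IsBasis B = Central B × Σ ℕ λ n → HasCard B n × Rank B n ×
      (∀ A → Central A → ∀ r → Rank A r → r ≤ n)

{-# OPTIONS --safe #-}
module Submission where

-- Let X₀ span the minimal flat over B, which carries a maximal chain of flats of length n = rk B.
-- Since z(X₀ ∘ −V) = z X₀ ∩ z V, minimality puts z X₀ inside every flat containing B.  If two
-- covectors vanishing on B differed at e, then one of them, or a covector obtained from them by
-- strong elimination at e, would vanish on z X₀ and at e ∉ z X₀.  Appending it to the chain gives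
-- a flat of rank ≥ n + 1 (ranks of flats exist because (Z) bounds chain lengths by the size of the
-- flat), contradicting the maximality of rk B.

open import Defs
open import Data.Product using (Σ; _×_; _,_; proj₁; proj₂)
open import Data.Nat using (ℕ; zero; suc; _+_; _≤_; _<_; z≤n; s≤s)
open import Data.Nat.Properties
  using ( ≤-refl; ≤-trans; +-mono-≤; +-mono-<-≤; +-mono-≤-<; +-monoʳ-<
        ; m≤m+n; ≤∧≢⇒<; <⇒≱; m<1+n⇒m≤n )
open import Data.Fin using (Fin; inject₁; fromℕ)
open import Data.List using (List; []; _∷_; length)
open import Data.List.Relation.Unary.Any using (here; there)
open import Data.List.Membership.Propositional using (_∈_)
open import Data.Sum using (_⊎_; inj₁; inj₂)
open import Function using (id)
open import Relation.Nullary using (¬_; Dec; yes; no; contradiction)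
open import Relation.Nullary.Decidable using (decidable-stable; ¬¬-excluded-middle)
open import Relation.Binary.PropositionalEquality using (_≡_; _≢_; refl; sym; trans; subst)

_≟ˢ_ : (a b : Sign) → Dec (a ≡ b)
⊕ ≟ˢ ⊕ = yes refl
⊕ ≟ˢ ⊖ = no λ ()
⊕ ≟ˢ 𝟎 = no λ ()
⊖ ≟ˢ ⊕ = no λ ()
⊖ ≟ˢ ⊖ = yes refl
⊖ ≟ˢ 𝟎 = no λ ()
𝟎 ≟ˢ ⊕ = no λ ()
𝟎 ≟ˢ ⊖ = no λ ()
𝟎 ≟ˢ 𝟎 = yes refl

bounded-¬¬-maximum : (P : ℕ → Set) (K : ℕ) → (∀ m → P m → m ≤ K) → ∀ m₀ → P m₀ →
  ¬ ¬ (Σ ℕ λ r → P r × (∀ m → P m → m ≤ r))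
bounded-¬¬-maximum P zero bound m₀ p₀ k with bound m₀ p₀
... | z≤n = k (zero , p₀ , bound)
bounded-¬¬-maximum P (suc K) bound m₀ p₀ k = ¬¬-excluded-middle λ
  { (yes pK) → k (suc K , pK , bound)
  ; (no ¬pK) → bounded-¬¬-maximum P K (bound-below ¬pK) m₀ p₀ k
  }
  where
  bound-below : ¬ P (suc K) → ∀ m → P m → m ≤ K
  bound-below ¬pK m pm = m<1+n⇒m≤n (≤∧≢⇒< (bound m pm) λ { refl → ¬pK pm })

snoc : ∀ {A : Set} {n} → (Fin (suc n) → A) → A → Fin (suc (suc n)) → A
snoc c w Fin.zero = c Fin.zero
snoc {n = zero} c w (Fin.suc i) = w
snoc {n = suc n} c w (Fin.suc i) = snoc (λ j → c (Fin.suc j)) w i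

snoc-all : ∀ {A : Set} (P : A → Set) {n} (c : Fin (suc n) → A) w →
  (∀ i → P (c i)) → P w → ∀ i → P (snoc c w i)
snoc-all P c w Pc Pw Fin.zero = Pc Fin.zero
snoc-all P {zero} c w Pc Pw (Fin.suc i) = Pw
snoc-all P {suc n} c w Pc Pw (Fin.suc i) = snoc-all P (λ j → c (Fin.suc j)) w (λ j → Pc (Fin.suc j)) Pw i

snoc-last : ∀ {A : Set} {n} (c : Fin (suc n) → A) w → snoc c w (fromℕ (suc n)) ≡ w
snoc-last {n = zero} c w = refl
snoc-last {n = suc n} c w = snoc-last (λ j → c (Fin.suc j)) w

snoc-steps : ∀ {A : Set} (R : A → A → Set) {n} (c : Fin (suc n) → A) w →
  (∀ (i : Fin n) → R (c (inject₁ i)) (c (Fin.suc i))) → R (c (fromℕ n)) w →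
  ∀ (i : Fin (suc n)) → R (snoc c w (inject₁ i)) (snoc c w (Fin.suc i))
snoc-steps R {zero} c w Rc Rw Fin.zero = Rw
snoc-steps R {suc n} c w Rc Rw Fin.zero = Rc Fin.zero
snoc-steps R {suc n} c w Rc Rw (Fin.suc i) =
  snoc-steps R (λ j → c (Fin.suc j)) w (λ j → Rc (Fin.suc j)) Rw i

isZero : Sign → ℕ
isZero 𝟎 = 1
isZero _ = 0

isZero≤1 : ∀ a → isZero a ≤ 1
isZero≤1 ⊕ = z≤n
isZero≤1 ⊖ = z≤n
isZero≤1 𝟎 = s≤s z≤n

isZero-mono : ∀ a b → (a ≡ 𝟎 → b ≡ 𝟎) → isZero a ≤ isZero b
isZero-mono ⊕ b h = z≤n
isZero-mono ⊖ b h = z≤n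
isZero-mono 𝟎 b h with h refl
... | refl = ≤-refl

isZero-strict : ∀ a b → a ≢ 𝟎 → b ≡ 𝟎 → isZero a < isZero b
isZero-strict ⊕ .𝟎 a≢𝟎 refl = s≤s z≤n
isZero-strict ⊖ .𝟎 a≢𝟎 refl = s≤s z≤n
isZero-strict 𝟎 .𝟎 a≢𝟎 refl = contradiction refl a≢𝟎

module _ {E : Set} where

  z-∘ˢ : ∀ (X Y : SignVec {E}) e → z X e → z Y e → z (X ∘ˢ Y) e
  z-∘ˢ X Y e Xe Ye rewrite Xe | Ye = refl

  z-∘ˢ⁻ : ∀ (X Y : SignVec {E}) e → z X e → z Y e → z (X ∘ˢ ⁻ Y) e
  z-∘ˢ⁻ X Y e Xe Ye rewrite Xe | Ye = refl

  z-∘ˢ⁻-inv : ∀ (X Y : SignVec {E}) e → z (X ∘ˢ ⁻ Y) e → z X e × z Y e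
  z-∘ˢ⁻-inv X Y e with X e | Y e
  ... | 𝟎 | 𝟎 = λ _ → refl , refl
  ... | 𝟎 | ⊕ = λ ()
  ... | 𝟎 | ⊖ = λ ()
  ... | ⊕ | _ = λ ()
  ... | ⊖ | _ = λ ()

  zeroCount : SignVec {E} → List E → ℕ
  zeroCount X [] = 0
  zeroCount X (e ∷ l) = isZero (X e) + zeroCount X l

  zeroCount≤length : ∀ X l → zeroCount X l ≤ length l
  zeroCount≤length X [] = z≤n
  zeroCount≤length X (e ∷ l) = +-mono-≤ (isZero≤1 (X e)) (zeroCount≤length X l)

  zeroCount-mono : ∀ P Q l → z P ⊆ z Q → zeroCount P l ≤ zeroCount Q l
  zeroCount-mono P Q [] P⊆Q = z≤n
  zeroCount-mono P Q (e ∷ l) P⊆Q = +-mono-≤ (isZero-mono (P e) (Q e) (P⊆Q e)) (zeroCount-mono P Q l P⊆Q)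

  zeroCount-<⊎⊇ : ∀ P Q l → z P ⊆ z Q →
    zeroCount P l < zeroCount Q l ⊎ (∀ e → e ∈ l → z Q e → z P e)
  zeroCount-<⊎⊇ P Q [] P⊆Q = inj₂ λ _ ()
  zeroCount-<⊎⊇ P Q (e ∷ l) P⊆Q with zeroCount-<⊎⊇ P Q l P⊆Q
  ... | inj₁ lt = inj₁ (+-mono-≤-< (isZero-mono (P e) (Q e) (P⊆Q e)) lt)
  ... | inj₂ Q⊆P with Q e ≟ˢ 𝟎 | P e ≟ˢ 𝟎
  ...   | yes Qe | no ¬Pe = inj₁ (+-mono-<-≤ (isZero-strict (P e) (Q e) ¬Pe Qe) (zeroCount-mono P Q l P⊆Q))
  ...   | yes Qe | yes Pe = inj₂ λ { f (here refl) _ → Pe ; f (there f∈l) → Q⊆P f f∈l }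
  ...   | no ¬Qe | _      = inj₂ λ { f (here refl) Qe → contradiction Qe ¬Qe ; f (there f∈l) → Q⊆P f f∈l }

  zeroCount-strict : ∀ P Q l → z P ⊂ z Q → (∀ e → z Q e → e ∈ l) → zeroCount P l < zeroCount Q l
  zeroCount-strict P Q l (P⊆Q , Q⊈P) Q⊆l with zeroCount-<⊎⊇ P Q l P⊆Q
  ... | inj₁ lt = lt
  ... | inj₂ Q⊆P = contradiction (λ e Qe → Q⊆P e (Q⊆l e Qe) Qe) Q⊈P

  StrictChain : ∀ m → (Fin (suc m) → SignVec {E}) → Set
  StrictChain m d = ∀ (i : Fin m) → z (d (inject₁ i)) ⊂ z (d (Fin.suc i))

  StrictChain-head⊆last : ∀ m d → StrictChain m d → z (d Fin.zero) ⊆ z (d (fromℕ m))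
  StrictChain-head⊆last zero d _ = λ _ → id
  StrictChain-head⊆last (suc m) d chain e d₀e =
    StrictChain-head⊆last m (λ j → d (Fin.suc j)) (λ i → chain (Fin.suc i)) e (proj₁ (chain Fin.zero) e d₀e)

  StrictChain-zeroCount : ∀ m d l → StrictChain m d → (∀ e → z (d (fromℕ m)) e → e ∈ l) →
    m + zeroCount (d Fin.zero) l ≤ zeroCount (d (fromℕ m)) l
  StrictChain-zeroCount zero d l _ _ = ≤-refl
  StrictChain-zeroCount (suc m) d l chain last⊆l = ≤-trans (+-monoʳ-< m first-step) rest
    where
    tail-chain : StrictChain m (λ j → d (Fin.suc j))
    tail-chain i = chain (Fin.suc i)
    rest : m + zeroCount (d (Fin.suc Fin.zero)) l ≤ zeroCount (d (fromℕ (suc m))) l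
    rest = StrictChain-zeroCount m (λ j → d (Fin.suc j)) l tail-chain last⊆l
    first-step : zeroCount (d Fin.zero) l < zeroCount (d (Fin.suc Fin.zero)) l
    first-step = zeroCount-strict (d Fin.zero) (d (Fin.suc Fin.zero)) l (chain Fin.zero)
      λ e d₁e → last⊆l e (StrictChain-head⊆last m (λ j → d (Fin.suc j)) tail-chain e d₁e)

  module _ (ℒ : SignVec {E} → Set) where

    ChainTo-length≤card : ∀ {F m k} → ChainTo ℒ F m → HasCard F k → m ≤ k
    ChainTo-length≤card {m = m} {k} (d , _ , chain , last≐F) (l , |l|≡k , _ , F⇔l) =
      ≤-trans (m≤m+n m _) (≤-trans
        (StrictChain-zeroCount m d l chain λ e de → proj₁ (F⇔l e) (proj₁ last≐F e de))
        (subst (zeroCount (d (fromℕ m)) l ≤_) |l|≡k (zeroCount≤length (d (fromℕ m)) l)))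

    ChainTo-snoc : ∀ {F n W} → ChainTo ℒ F n → ℒ W → F ⊂ z W → ChainTo ℒ (z W) (suc n)
    ChainTo-snoc {W = W} (c , ℒc , chain , last≐F) ℒW (F⊆W , W⊈F) =
        snoc c W
      , snoc-all ℒ c W ℒc ℒW
      , snoc-steps (λ P Q → z P ⊂ z Q) c W chain
          ((λ e ce → F⊆W e (proj₁ last≐F e ce)) , λ W⊆c → W⊈F λ e We → proj₁ last≐F e (W⊆c e We))
      , subst (λ V → z V ≐ z W) (sym (snoc-last c W)) ((λ _ → id) , (λ _ → id))

    MinimalFlatOver-self : ∀ {W} → ℒ W → MinimalFlatOver ℒ (z W) W
    MinimalFlatOver-self ℒW = ℒW , (λ _ → id) , λ _ _ W⊆Y _ → W⊆Y

    MinimalFlatOver-least : FS ℒ → ∀ {A X V} → MinimalFlatOver ℒ A X → ℒ V → A ⊆ z V → z X ⊆ z V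
    MinimalFlatOver-least fs {X = X} {V} (ℒX , A⊆X , minimal) ℒV A⊆V e Xe =
      proj₂ (z-∘ˢ⁻-inv X V e (minimal (X ∘ˢ ⁻ V) (fs X V ℒX ℒV)
        (λ f Af → z-∘ˢ⁻ X V f (A⊆X f Af) (A⊆V f Af))
        (λ f XVf → proj₁ (z-∘ˢ⁻-inv X V f XVf)) e Xe))

    maxRank⇒¬⊂flat : ZFinite ℒ → ∀ {F n W} → ChainTo ℒ F n →
      (∀ A → Central ℒ A → ∀ r → Rank ℒ A r → r ≤ n) → ℒ W → ¬ (F ⊂ z W)
    maxRank⇒¬⊂flat zf {n = n} {W} chain rank≤n ℒW F⊂W with zf W ℒW
    ... | k , |W|≡k =
      bounded-¬¬-maximum (ChainTo ℒ (z W)) k (λ m c → ChainTo-length≤card c |W|≡k) (suc n) longer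
        λ (r , chainᵣ , maximal) →
          <⇒≱ (maximal (suc n) longer)
            (rank≤n (z W) (W , ℒW , λ _ → id) r (W , MinimalFlatOver-self ℒW , chainᵣ , maximal))
      where
      longer : ChainTo ℒ (z W) (suc n)
      longer = ChainTo-snoc chain ℒW F⊂W

    vanishing-at-disagreement : SE ℒ → ∀ {F X Y e} → ℒ X → ℒ Y → F ⊆ z X → F ⊆ z Y → X e ≢ Y e →
      Σ SignVec λ W → ℒ W × F ⊆ z W × z W e
    vanishing-at-disagreement se {F} {X} {Y} {e} ℒX ℒY F⊆X F⊆Y Xe≢Ye with X e ≟ˢ 𝟎 | Y e ≟ˢ 𝟎
    ... | yes Xe | _ = X , ℒX , F⊆X , Xe
    ... | no _ | yes Ye = Y , ℒY , F⊆Y , Ye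
    ... | no Xe≢𝟎 | no Ye≢𝟎 with se X Y ℒX ℒY e (Xe≢𝟎 , Ye≢𝟎 , Xe≢Ye)
    ...   | Z , ℒZ , Ze , agree = Z , ℒZ , F⊆Z , Ze
      where
      F⊆Z : F ⊆ z Z
      F⊆Z f Ff = trans (agree f λ sep → proj₁ sep (F⊆X f Ff)) (z-∘ˢ X Y f (F⊆X f Ff) (F⊆Y f Ff))

    basis-covectors-agree : IsAOM ℒ → ZFinite ℒ → ∀ {B} → IsBasis ℒ B →
      ∀ {X Y} → ℒ X → ℒ Y → B ⊆ z X → B ⊆ z Y → X ≗ˢ Y
    basis-covectors-agree aom zf (_ , _ , _ , (X₀ , minimal , chain , _) , rank≤n) {X} {Y} ℒX ℒY B⊆X B⊆Y e =
      decidable-stable (X e ≟ˢ Y e) λ Xe≢Ye →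
        let X₀⊆X = MinimalFlatOver-least fs minimal ℒX B⊆X
            X₀⊆Y = MinimalFlatOver-least fs minimal ℒY B⊆Y
            W , ℒW , X₀⊆W , We = vanishing-at-disagreement se ℒX ℒY X₀⊆X X₀⊆Y Xe≢Ye
            e∉X₀ : ¬ z X₀ e
            e∉X₀ X₀e = Xe≢Ye (trans (X₀⊆X e X₀e) (sym (X₀⊆Y e X₀e)))
        in maxRank⇒¬⊂flat zf chain rank≤n ℒW (X₀⊆W , λ W⊆X₀ → e∉X₀ (W⊆X₀ e We))
      where open IsAOM aom

corollary3p25 : {E : Set} (ℒ : SignVec {E} → Set) → IsAOM ℒ → ZFinite ℒ →
    (B : Subset {E}) → IsBasis ℒ B →
    Σ (SignVec {E}) λ X → (ℒ X × (B ⊆ z X)) ×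
      -- X is minimal in Cov(ℒ) among covectors whose zero set contains B
      (∀ Y → ℒ Y → B ⊆ z Y → Y ≤ᶜ X → Y ≗ˢ X) ×
      -- X is the unique such minimal element
      (∀ W → ℒ W → B ⊆ z W → (∀ Y → ℒ Y → B ⊆ z Y → Y ≤ᶜ W → Y ≗ˢ W) → W ≗ˢ X) ×
      -- in fact X is the only covector whose zero set contains B
      (∀ Y → ℒ Y → B ⊆ z Y → Y ≗ˢ X)
corollary3p25 ℒ aom zf B basis@((X , ℒX , B⊆X) , _) =
  X , (ℒX , B⊆X) , (λ Y ℒY B⊆Y _ → unique Y ℒY B⊆Y) , (λ W ℒW B⊆W _ → unique W ℒW B⊆W) , unique
  where
  unique : ∀ Y → ℒ Y → B ⊆ z Y → Y ≗ˢ X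
  unique Y ℒY B⊆Y = basis-covectors-agree ℒ aom zf basis ℒY ℒX B⊆Y B⊆X
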